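{- Let $R$ be a finite commutative ring and $V$ a finite $R$-module, and let $\mathrm{Aff}(V)$ be the affine monoid of $V$. \begin{enumerate} \item The set of idempotents of $\mathrm{Aff}(V)$ is $E(\mathrm{Aff}(V))=\{ex+b\mid e\in E(R),\ b\in V,\ eb=0\}$. \item $E(\mathrm{Aff}(V))$ is a submonoid of $\mathrm{Aff}(V)$ and is a left regular band. \item If $ex+b,\ fx+c\in E(\mathrm{Aff}(V))$, then $ex+b\leq_{\mathscr J} fx+c$ if and only if $Re\subseteq Rf$. In particular, $ex+b\mathrel{\mathscr J} fx+c$ if and only if $e=f$. \item If $e\in E(R)$, then $E(Re)=\{f\in E(R)\mid Rf\subseteq Re\}$. \end{enumerate}
   Context: $\mathrm{Aff}(V)$ is the monoid of all maps $V\to V$ of the form $x\mapsto ax+b$ with $a\in R$, $b\in V$ (written $ax+b$), under composition, so $(ax+b)(cx+d)=acx+ad+b$. $E(M)$ denotes the set of idempotents of a monoid (or the multiplicative monoid of a ring) $M$. A left regular band is a monoid satisfying $xyx=xy$ for all $x,y$. For a monoid $M$ and $m,n\in M$: $m\leq_{\mathscr J} n$ means $MmM\subseteq MnM$, and $m\mathrel{\mathscr J} n$ means $MmM=MnM$. -}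

module Defs where

open import Level using (Level; _⊔_)
open import Data.Nat using (ℕ)
open import Data.Fin using (Fin)
open import Data.Product using (Σ; ∃; ∃-syntax; _×_; _,_)
open import Relation.Binary.Bundles using (Setoid)
open import Algebra.Bundles using (CommutativeRing)
open import Algebra.Module.Bundles using (Module)

Finite : ∀ {a ℓ} → Setoid a ℓ → Set (a ⊔ ℓ)
Finite S = ∃[ n ] Σ (Fin n → Carrier) λ enum → ∀ x → ∃[ i ] (enum i ≈ x)
  where open Setoid S

module AffMonoid {c ℓ m ℓm} (R : CommutativeRing c ℓ) (V : Module R m ℓm) where
  open CommutativeRing R
  open Module V

  -- An element (a , b) of Aff(V) stands for the affine map x ↦ a x + b.
  Aff : Set (c ⊔ m)
  Aff = Carrier × Carrierᴹ

  -- (a x + b)(c x + d) = a c x + (a d + b)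
  _∘ᴬ_ : Aff → Aff → Aff
  (a , b) ∘ᴬ (c' , d) = (a * c' , (a *ₗ d) +ᴹ b)

  idᴬ : Aff
  idᴬ = (1# , 0ᴹ)

  _≈ᴬ_ : Aff → Aff → Set (ℓ ⊔ ℓm)
  (a , b) ≈ᴬ (c' , d) = (a ≈ c') × (b ≈ᴹ d)

  IsIdemR : Carrier → Set ℓ
  IsIdemR e = e * e ≈ e

  IsIdemA : Aff → Set (ℓ ⊔ ℓm)
  IsIdemA x = (x ∘ᴬ x) ≈ᴬ x

  _∈R·_ : Carrier → Carrier → Set (c ⊔ ℓ)
  x ∈R· e = ∃[ r ] (x ≈ r * e)

  _⊆R·_ : Carrier → Carrier → Set (c ⊔ ℓ)
  e ⊆R· f = ∀ x → x ∈R· e → x ∈R· f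

  -- E(R e): idempotents of the ring R e (whose multiplication is that of R)
  IsIdemRe : Carrier → Carrier → Set (c ⊔ ℓ)
  IsIdemRe e f = (f ∈R· e) × IsIdemR f

  _∈M_M : Aff → Aff → Set (c ⊔ m ⊔ ℓ ⊔ ℓm)
  z ∈M x M = ∃[ u ] ∃[ w ] (z ≈ᴬ (u ∘ᴬ (x ∘ᴬ w)))

  _≤J_ : Aff → Aff → Set (c ⊔ m ⊔ ℓ ⊔ ℓm)
  x ≤J y = ∀ z → z ∈M x M → z ∈M y M

  _≡J_ : Aff → Aff → Set (c ⊔ m ⊔ ℓ ⊔ ℓm)
  x ≡J y = (x ≤J y) × (y ≤J x)

-- Everything rests on one computation: (a , b) ∘ (a , b) = (a a , a b + b),
-- so (a , b) is idempotent exactly when a ∈ E(R) and a b = 0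
-- ('idempotent⇔').  Closure under composition and the left regular band law
-- then follow because the annihilator of a vector is an ideal of R
-- ('annihilator-ideal').  For the J-order we show that the two-sided ideal
-- M (a , b) M of M = Aff(V) consists of all maps whose linear part lies in the
-- principal ideal R a ('∈M-M⇔'); hence x ≤J y iff R a ⊆ R a' for arbitrary
-- affine maps, and for idempotents J-equivalence is equality of linear parts,
-- since idempotents generating the same principal ideal coincide
-- ('idempotent-antisym').  Part (4) is the remark that R f ⊆ R e iff f ∈ R e.

module Submission where

open import Defs
open import Data.Product using (∃-syntax; _×_; _,_; proj₁; proj₂)
open import Function.Bundles using (_⇔_; mk⇔; Equivalence)
open import Algebra.Bundles using (CommutativeRing)
open import Algebra.Module.Bundles using (Module)
import Algebra.Properties.CommutativeSemigroup as CommutativeSemigroupProperties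
import Algebra.Properties.Group as GroupProperties
import Relation.Binary.Reasoning.Setoid as SetoidReasoning

module AffineIdempotents {c ℓ m ℓm} (R : CommutativeRing c ℓ) (V : Module R m ℓm) where
  open CommutativeRing R
  open Module V
  open AffMonoid R V
  open Equivalence using (to; from)
  private
    module *-Properties = CommutativeSemigroupProperties *-commutativeSemigroup
    module +ᴹ-Properties = GroupProperties +ᴹ-group

  ≈⇒∈R· : ∀ {x y} → x ≈ y → x ∈R· y
  ≈⇒∈R· {y = y} x≈y = 1# , trans x≈y (sym (*-identityˡ y))

  ∈R·-trans : ∀ {x e f} → x ∈R· e → e ∈R· f → x ∈R· f
  ∈R·-trans {x} {e} {f} (r , x≈re) (s , e≈sf) = r * s , (begin
      x           ≈⟨ x≈re ⟩
      r * e       ≈⟨ *-congˡ e≈sf ⟩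
      r * (s * f) ≈⟨ *-assoc r s f ⟨
      (r * s) * f ∎)
    where open SetoidReasoning setoid

  ⊆R·⇔∈R· : ∀ {e f} → (e ⊆R· f) ⇔ (e ∈R· f)
  ⊆R·⇔∈R· = mk⇔ (λ e⊆f → e⊆f _ (≈⇒∈R· refl)) (λ e∈f x x∈e → ∈R·-trans x∈e e∈f)

  idempotent-* : ∀ {e f} → IsIdemR e → IsIdemR f → IsIdemR (e * f)
  idempotent-* {e} {f} ee≈e ff≈f = trans (*-Properties.interchange e f e f) (*-cong ee≈e ff≈f)

  idempotent-absorb : ∀ {e f} → e ∈R· f → IsIdemR f → e ≈ e * f
  idempotent-absorb {e} {f} (r , e≈rf) ff≈f = begin
      e           ≈⟨ e≈rf ⟩
      r * f       ≈⟨ *-congˡ ff≈f ⟨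
      r * (f * f) ≈⟨ *-assoc r f f ⟨
      (r * f) * f ≈⟨ *-congʳ e≈rf ⟨
      e * f       ∎
    where open SetoidReasoning setoid

  idempotent-antisym : ∀ {e f} → IsIdemR e → IsIdemR f → e ∈R· f → f ∈R· e → e ≈ f
  idempotent-antisym {e} {f} ee≈e ff≈f e∈f f∈e = begin
      e     ≈⟨ idempotent-absorb e∈f ff≈f ⟩
      e * f ≈⟨ *-comm e f ⟩
      f * e ≈⟨ idempotent-absorb f∈e ee≈e ⟨
      f     ∎
    where open SetoidReasoning setoid

  annihilator-ideal : ∀ {a s b} → a *ₗ b ≈ᴹ 0ᴹ → s ∈R· a → s *ₗ b ≈ᴹ 0ᴹ
  annihilator-ideal {a} {s} {b} ab≈0 (r , s≈ra) = begin
      s *ₗ b        ≈⟨ *ₗ-congʳ s≈ra ⟩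
      (r * a) *ₗ b  ≈⟨ *ₗ-assoc r a b ⟩
      r *ₗ (a *ₗ b) ≈⟨ *ₗ-congˡ ab≈0 ⟩
      r *ₗ 0ᴹ       ≈⟨ *ₗ-zeroʳ r ⟩
      0ᴹ            ∎
    where open SetoidReasoning ≈ᴹ-setoid

  ∘ᴬ-cong : ∀ {x x' y y'} → x ≈ᴬ x' → y ≈ᴬ y' → (x ∘ᴬ y) ≈ᴬ (x' ∘ᴬ y')
  ∘ᴬ-cong (a≈a' , b≈b') (c≈c' , d≈d') = *-cong a≈a' c≈c' , +ᴹ-cong (*ₗ-cong a≈a' d≈d') b≈b'

  idempotentᴬ-resp : ∀ {x y} → x ≈ᴬ y → IsIdemA y → IsIdemA x
  idempotentᴬ-resp (a≈a' , b≈b') (a'a'≈a' , a'b'+b'≈b') =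
    let (aa≈a'a' , ab+b≈a'b'+b') = ∘ᴬ-cong (a≈a' , b≈b') (a≈a' , b≈b')
    in trans aa≈a'a' (trans a'a'≈a' (sym a≈a'))
     , ≈ᴹ-trans ab+b≈a'b'+b' (≈ᴹ-trans a'b'+b'≈b' (≈ᴹ-sym b≈b'))

  -- The key computation: a x + b is idempotent iff a ∈ E(R) and a b = 0,
  -- because its square is a a x + (a b + b).
  idempotent⇔ : ∀ a b → IsIdemA (a , b) ⇔ (IsIdemR a × a *ₗ b ≈ᴹ 0ᴹ)
  idempotent⇔ a b = mk⇔
    (λ (aa≈a , ab+b≈b) → aa≈a , +ᴹ-Properties.identityˡ-unique (a *ₗ b) b ab+b≈b)
    (λ (aa≈a , ab≈0) → aa≈a , ≈ᴹ-trans (+ᴹ-congʳ ab≈0) (+ᴹ-identityˡ b))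

  idempotents : ∀ x → IsIdemA x ⇔ (∃[ e ] ∃[ b ] (IsIdemR e × (e *ₗ b) ≈ᴹ 0ᴹ × x ≈ᴬ (e , b)))
  idempotents (a , b) = mk⇔
    (λ idem → let (aa≈a , ab≈0) = to (idempotent⇔ a b) idem in a , b , aa≈a , ab≈0 , refl , ≈ᴹ-refl)
    (λ (e , b' , ee≈e , eb'≈0 , x≈eb') → idempotentᴬ-resp x≈eb' (from (idempotent⇔ e b') (ee≈e , eb'≈0)))

  idᴬ-idempotent : IsIdemA idᴬ
  idᴬ-idempotent = from (idempotent⇔ 1# 0ᴹ) (*-identityˡ 1# , *ₗ-zeroʳ 1#)

  -- ... idempotents are closed under composition, since e f ∈ E(R) and
  -- (e f)(e c + b) = (e f e) c + (e f) b, where e f e ∈ R f kills c and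
  -- e f ∈ R e kills b, ...
  ∘ᴬ-idempotent : ∀ x y → IsIdemA x → IsIdemA y → IsIdemA (x ∘ᴬ y)
  ∘ᴬ-idempotent (e , b) (f , c') idem-x idem-y =
    from (idempotent⇔ (e * f) (e *ₗ c' +ᴹ b)) (idempotent-* ee≈e ff≈f , annihilated)
    where
      open SetoidReasoning ≈ᴹ-setoid
      ee≈e = proj₁ (to (idempotent⇔ e b) idem-x)
      eb≈0 = proj₂ (to (idempotent⇔ e b) idem-x)
      ff≈f = proj₁ (to (idempotent⇔ f c') idem-y)
      fc≈0 = proj₂ (to (idempotent⇔ f c') idem-y)
      annihilated : (e * f) *ₗ (e *ₗ c' +ᴹ b) ≈ᴹ 0ᴹ
      annihilated = begin
        (e * f) *ₗ (e *ₗ c' +ᴹ b)            ≈⟨ *ₗ-distribˡ (e * f) (e *ₗ c') b ⟩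
        (e * f) *ₗ (e *ₗ c') +ᴹ (e * f) *ₗ b ≈⟨ +ᴹ-congʳ (*ₗ-assoc (e * f) e c') ⟨
        ((e * f) * e) *ₗ c' +ᴹ (e * f) *ₗ b  ≈⟨ +ᴹ-cong (annihilator-ideal fc≈0 (e * e , *-Properties.xy∙z≈xz∙y e f e))
                                                         (annihilator-ideal eb≈0 (f , *-comm e f)) ⟩
        0ᴹ +ᴹ 0ᴹ                             ≈⟨ +ᴹ-identityˡ 0ᴹ ⟩
        0ᴹ                                   ∎

  -- ... and they form a left regular band: (e x + b)(f x + c)(e x + b) has
  -- linear part e f e = e f and translation (e f) b + (e c + b) = e c + b.
  left-regular : ∀ x y → IsIdemA x → IsIdemA y → ((x ∘ᴬ y) ∘ᴬ x) ≈ᴬ (x ∘ᴬ y)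
  left-regular (e , b) (f , c') idem-x _ =
    trans (*-Properties.xy∙z≈xz∙y e f e) (*-congʳ ee≈e)
    , ≈ᴹ-trans (+ᴹ-congʳ (annihilator-ideal eb≈0 (f , *-comm e f))) (+ᴹ-identityˡ _)
    where
      ee≈e = proj₁ (to (idempotent⇔ e b) idem-x)
      eb≈0 = proj₂ (to (idempotent⇔ e b) idem-x)

  -- The two-sided ideal M (a x + b) M consists exactly of the affine maps
  -- whose linear part lies in R a: a product u (a x + b) w has linear part
  -- u₁ a w₁, and t a x + z is realised as (t x + (z - t b)) (a x + b) idᴬ.
  ∈M-M⇔ : ∀ z x → (z ∈M x M) ⇔ (proj₁ z ∈R· proj₁ x)
  ∈M-M⇔ (z₁ , z₂) (a , b) = mk⇔ linear-part realise
    where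
      linear-part : (z₁ , z₂) ∈M (a , b) M → z₁ ∈R· a
      linear-part ((u₁ , _) , (w₁ , _) , z₁≈u₁aw₁ , _) =
        u₁ * w₁ , trans z₁≈u₁aw₁ (*-Properties.x∙yz≈xz∙y u₁ a w₁)
      realise : z₁ ∈R· a → (z₁ , z₂) ∈M (a , b) M
      realise (t , z₁≈ta) =
        let q = t *ₗ (a *ₗ 0ᴹ +ᴹ b)
        in (t , -ᴹ q +ᴹ z₂) , idᴬ
           , trans z₁≈ta (*-congˡ (sym (*-identityʳ a)))
           , ≈ᴹ-sym (+ᴹ-Properties.\\-leftDividesˡ q z₂)

  ≤J⇔⊆R· : ∀ x y → (x ≤J y) ⇔ (proj₁ x ⊆R· proj₁ y)
  ≤J⇔⊆R· x y = mk⇔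
    (λ x≤y → from ⊆R·⇔∈R· (to (∈M-M⇔ x y) (x≤y x (from (∈M-M⇔ x x) (≈⇒∈R· refl)))))
    (λ a⊆a' z z∈MxM → from (∈M-M⇔ z y) (a⊆a' (proj₁ z) (to (∈M-M⇔ z x) z∈MxM)))

  ≡J⇔≈ : ∀ e b f c' → IsIdemR e → IsIdemR f → ((e , b) ≡J (f , c')) ⇔ (e ≈ f)
  ≡J⇔≈ e b f c' ee≈e ff≈f = mk⇔
    (λ (x≤y , y≤x) → idempotent-antisym ee≈e ff≈f (generator x≤y) (generator y≤x))
    (λ e≈f → from (≤J⇔⊆R· _ _) (from ⊆R·⇔∈R· (≈⇒∈R· e≈f))
           , from (≤J⇔⊆R· _ _) (from ⊆R·⇔∈R· (≈⇒∈R· (sym e≈f))))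
    where
      generator : ∀ {x y} → x ≤J y → proj₁ x ∈R· proj₁ y
      generator {x} {y} x≤y = to ⊆R·⇔∈R· (to (≤J⇔⊆R· x y) x≤y)

  idempotents-of-ideal : ∀ e f → IsIdemRe e f ⇔ (IsIdemR f × (f ⊆R· e))
  idempotents-of-ideal e f = mk⇔
    (λ (f∈e , ff≈f) → ff≈f , from ⊆R·⇔∈R· f∈e)
    (λ (ff≈f , f⊆e) → to ⊆R·⇔∈R· f⊆e , ff≈f)

proposition3p2 : ∀ {c ℓ m ℓm} (R : CommutativeRing c ℓ) (V : Module R m ℓm)
  → Finite (CommutativeRing.setoid R) → Finite (Module.≈ᴹ-setoid V)
  → let open CommutativeRing R
        open Module V
        open AffMonoid R V
    in
    -- (1) E(Aff(V)) = { e x + b | e ∈ E(R), b ∈ V, e b = 0 }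
    (∀ x → IsIdemA x ⇔ (∃[ e ] ∃[ b ] (IsIdemR e × (e *ₗ b) ≈ᴹ 0ᴹ × x ≈ᴬ (e , b))))
    -- (2) E(Aff(V)) is a submonoid and a left regular band
    × (IsIdemA idᴬ
       × (∀ x y → IsIdemA x → IsIdemA y → IsIdemA (x ∘ᴬ y))
       × (∀ x y → IsIdemA x → IsIdemA y → ((x ∘ᴬ y) ∘ᴬ x) ≈ᴬ (x ∘ᴬ y)))
    -- (3) J-order and J-equivalence on idempotents
    × (∀ e b f c' → IsIdemA (e , b) → IsIdemA (f , c')
       → (((e , b) ≤J (f , c')) ⇔ (e ⊆R· f))
         × (((e , b) ≡J (f , c')) ⇔ (e ≈ f)))
    -- (4) E(R e) = { f ∈ E(R) | R f ⊆ R e }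
    × (∀ e → IsIdemR e → ∀ f → IsIdemRe e f ⇔ (IsIdemR f × (f ⊆R· e)))
proposition3p2 R V _ _ =
  idempotents
  , (idᴬ-idempotent , ∘ᴬ-idempotent , left-regular)
  , (λ e b f c' (ee≈e , _) (ff≈f , _) → ≤J⇔⊆R· (e , b) (f , c') , ≡J⇔≈ e b f c' ee≈e ff≈f)
  , (λ e _ → idempotents-of-ideal e)
  where open AffineIdempotents R V
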